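{- Let $t>0$ be an integer and let $$\mathcal{R}_t:=\{k\in\mathscr{V}\,:\ \text{there exist a prime } q \text{ and an integer } j\ge t \text{ with } q^j\in\phi^{ -1}(k)\}.$$ Then $|\mathcal{R}_t(x)|=o(\sqrt[t]{x})$ as $x\to\infty$, where $\mathcal{R}_t(x)=\{k\in\mathcal{R}_t: k\le x\}$.
   Context: $\phi$ denotes Euler's totient function and $\mathscr{V}=\{\phi(n):n\ge 1\}$ is the set of totients. For a set $U$ of positive integers and a real $x$, $U(x)=\{n\in U: n\le x\}$. -}

module Defs where

open import Data.Nat using (ℕ; suc; _≤_; _^_)
open import Data.Nat.GCD using (gcd)
open import Data.Nat.Primality using (Prime)
open import Data.List using (List; filter; length; upTo)
open import Data.Nat.Properties using (_≟_)
open import Data.Product using (Σ; _×_; ∃)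
open import Relation.Binary.PropositionalEquality using (_≡_)

-- Euler's totient: φ n = #{ m : 1 ≤ m ≤ n, gcd m n = 1 }.
-- (upTo n = [0 .. n-1]; we shift by one to range over 1..n.)
φ : ℕ → ℕ
φ n = length (filter (λ m → gcd (suc m) n ≟ 1) (upTo n))

Totient : ℕ → Set
Totient k = Σ ℕ λ n → 1 ≤ n × φ n ≡ k

R : ℕ → ℕ → Set
R t k = Totient k × (Σ ℕ λ q → Σ ℕ λ j → Prime q × t ≤ j × φ (q ^ j) ≡ k)

{-# OPTIONS --safe #-}
module Submission where

-- Since φ(q^j) ≥ q^j/2, an element k ≤ x of 𝓡_t is φ(q^j) for a prime power with q^j ≤ 2x.
-- Put w = m·|L| and suppose x < w^t.  If j = t then q < 2w, so k is one of the π(2w) values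
-- φ(q^t).  If j > t, write j = r + s(t+1) with r ≤ t, s ≥ 1 and u = q^s; then
-- k = φ(u^(t+1) · q^r) where q is the least factor of u, and u^(t+1) < 2w^t forces u·c < w
-- once w > 2c^(t+1).  So |L| ≤ π(2w) + (w/c + 1)(t+1).  By Chebyshev's argument (the primes
-- in (n, 2n] divide C(2n, n) ≤ 4^n) π(y) = o(y), and with c = 4m(t+1) this makes m·|L| < w
-- for all large w: the case x < w^t occurs only below an explicit bound W, and W^t works as X.

open import Defs
open import Data.Nat using (ℕ; _≤_; _*_; _^_)
open import Data.List using (List; length)
open import Data.List.Relation.Unary.All using (All)
open import Data.List.Relation.Unary.Unique.Propositional using (Unique)
open import Data.Product using (Σ; _×_)

open import Data.Nat
open import Data.Nat.Properties
import Algebra.Properties.CommutativeSemigroup +-commutativeSemigroup as +-CS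
import Algebra.Properties.CommutativeSemigroup *-commutativeSemigroup as *-CS
open import Data.Nat.Divisibility
open import Data.Nat.DivMod using (m≡m%n+[m/n]*n; m%n<n; m/n*n≤m; m/n*n≡m; m*n/n≡m; /-monoˡ-≤; m≥n⇒m/n>0)
open import Data.Nat.Coprimality as Coprimality using (Coprime; coprime-divisor; coprime⇒gcd≡1; prime⇒coprime)
open import Data.Nat.GCD using (gcd)
open import Data.Nat.LCM using (lcm; lcm-least; gcd*lcm)
open import Data.Nat.Primality
open import Data.Nat.Combinatorics using (_C_; nCk≡nC[n∸k]; nCn≡1; nCk+nC[k+1]≡[n+1]C[k+1]; nCk≡n!/k![n-k]!; k![n∸k]!∣n!)
open import Data.Nat.Combinatorics.Specification using (k>n⇒nCk≡0)
open import Data.Nat.Induction using (<-rec)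
open import Data.Nat.ListAction using (product)
open import Data.Nat.Tactic.RingSolver using (solve-∀)
open import Data.List using ([]; _∷_; map; filter; applyUpTo; upTo; _++_; cartesianProductWith)
open import Data.List.Properties using (length-++; length-map; length-upTo; length-filter; filter-++; filter-all; length-applyUpTo)
open import Data.List.Relation.Unary.All as All using ([]; _∷_)
import Data.List.Relation.Unary.All.Properties as All
open import Data.List.Relation.Unary.AllPairs using ([]; _∷_)
import Data.List.Relation.Unary.Unique.Propositional.Properties as Unique
open import Data.List.Relation.Unary.Any using (here; there)
open import Data.List.Membership.Propositional using (_∈_)
open import Data.List.Membership.Propositional.Properties
  using (∈-∃++; ∈-++⁺ˡ; ∈-++⁺ʳ; ∈-map⁺; ∈-upTo⁺; ∈-filter⁺; ∈-cartesianProductWith⁺)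
open import Data.Product using (_,_; proj₁; proj₂)
open import Data.Sum using (inj₁; inj₂)
open import Data.Empty using (⊥-elim)
open import Function using (_∘_; id)
open import Relation.Nullary using (¬_; yes; no)
open import Relation.Unary using (Decidable)
open import Relation.Binary.PropositionalEquality

^-distribʳ-* : ∀ m n k → (m * n) ^ k ≡ m ^ k * n ^ k
^-distribʳ-* m n zero    = refl
^-distribʳ-* m n (suc k) = begin
  m * n * (m * n) ^ k       ≡⟨ cong (m * n *_) (^-distribʳ-* m n k) ⟩
  m * n * (m ^ k * n ^ k)   ≡⟨ *-CS.interchange m n (m ^ k) (n ^ k) ⟩
  m * m ^ k * (n * n ^ k)   ∎
  where open ≡-Reasoning

2*m≤n⇒m<n : ∀ {m n} → 2 ≤ n → 2 * m ≤ n → m < n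
2*m≤n⇒m<n {zero}  2≤n _     = ≤-trans (s≤s z≤n) 2≤n
2*m≤n⇒m<n {suc m} _   2m≤n = ≤-trans (m<m+n (suc m) z<s) 2m≤n

halve : ∀ Y → Σ ℕ λ n → n + n ≤ Y × Y ≤ suc n + n
halve Y = n , ≤-trans (≤-reflexive (sym n*2≡n+n)) (m/n*n≤m Y 2) , Y≤
  where
    n = Y / 2
    n*2≡n+n : n * 2 ≡ n + n
    n*2≡n+n = trans (*-comm n 2) (cong (n +_) (+-identityʳ n))
    Y≤ : Y ≤ suc n + n
    Y≤ = begin
      Y                ≡⟨ m≡m%n+[m/n]*n Y 2 ⟩
      Y % 2 + n * 2    ≤⟨ +-monoˡ-≤ (n * 2) (≤-pred (m%n<n Y 2)) ⟩
      suc (n * 2)      ≡⟨ cong suc n*2≡n+n ⟩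
      suc n + n        ∎
      where open ≤-Reasoning

m^n<2*o^n⇒m<2*o : ∀ {m o} n .{{_ : NonZero n}} → m ^ n < 2 * o ^ n → m < 2 * o
m^n<2*o^n⇒m<2*o {m} {o} n@(suc k) m^n<2o^n with m <? 2 * o
... | yes m<2o = m<2o
... | no  2o≤m = ⊥-elim (<⇒≱ m^n<2o^n (begin
  2 * o ^ n         ≤⟨ *-monoˡ-≤ (o ^ n) (*-monoʳ-≤ 2 (m^n>0 2 k)) ⟩
  2 ^ n * o ^ n     ≡⟨ ^-distribʳ-* 2 o n ⟨
  (2 * o) ^ n       ≤⟨ ^-monoˡ-≤ n (≮⇒≥ 2o≤m) ⟩
  m ^ n             ∎))
  where open ≤-Reasoning

u^[1+t]<2*w^t⇒u*c<w : ∀ {u w} c .{{_ : NonZero c}} t → u ^ suc t < 2 * w ^ t → 2 * c ^ suc t < w → u * c < w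
u^[1+t]<2*w^t⇒u*c<w {u} {w} c t u^[1+t]<2w^t 2c^[1+t]<w with u * c <? w
... | yes uc<w = uc<w
... | no  w≤uc = ⊥-elim (<⇒≱ 2c^[1+t]<w (<⇒≤ w<2c^[1+t]))
  where
    open ≤-Reasoning
    w<2c^[1+t] : w < 2 * c ^ suc t
    w<2c^[1+t] = *-cancelʳ-< (w ^ t) w (2 * c ^ suc t) (begin-strict
      w * w ^ t                 ≤⟨ ^-monoˡ-≤ (suc t) (≮⇒≥ w≤uc) ⟩
      (u * c) ^ suc t           ≡⟨ ^-distribʳ-* u c (suc t) ⟩
      u ^ suc t * c ^ suc t     <⟨ *-monoˡ-< (c ^ suc t) {{m^n≢0 c (suc t)}} u^[1+t]<2w^t ⟩
      2 * w ^ t * c ^ suc t     ≡⟨ *-CS.xy∙z≈xz∙y 2 (w ^ t) (c ^ suc t) ⟩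
      2 * c ^ suc t * w ^ t     ∎)

-- Counting in lists

applyUpTo-+ : ∀ {a} {A : Set a} (f : ℕ → A) m n →
              applyUpTo f (m + n) ≡ applyUpTo f m ++ applyUpTo (f ∘ (m +_)) n
applyUpTo-+ f zero    n = refl
applyUpTo-+ f (suc m) n = cong (f 0 ∷_) (applyUpTo-+ (f ∘ suc) m n)

module _ {P : ℕ → Set} (P? : Decidable P) where

  count : (ℕ → ℕ) → ℕ → ℕ
  count f n = length (filter P? (applyUpTo f n))

  count-+ : ∀ f m n → count f (m + n) ≡ count f m + count (f ∘ (m +_)) n
  count-+ f m n = begin
    length (filter P? (applyUpTo f (m + n)))
      ≡⟨ cong (length ∘ filter P?) (applyUpTo-+ f m n) ⟩
    length (filter P? (applyUpTo f m ++ applyUpTo (f ∘ (m +_)) n))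
      ≡⟨ cong length (filter-++ P? (applyUpTo f m) _) ⟩
    length (filter P? (applyUpTo f m) ++ filter P? (applyUpTo (f ∘ (m +_)) n))
      ≡⟨ length-++ (filter P? (applyUpTo f m)) ⟩
    count f m + count (f ∘ (m +_)) n ∎
    where open ≡-Reasoning

  count≤n : ∀ f n → count f n ≤ n
  count≤n f n = ≤-trans (length-filter P? (applyUpTo f n)) (≤-reflexive (length-applyUpTo f n))

  count-mono : ∀ f {m n} → m ≤ n → count f m ≤ count f n
  count-mono f {m} {n} m≤n = begin
    count f m                             ≤⟨ m≤m+n (count f m) _ ⟩
    count f m + count (f ∘ (m +_)) (n ∸ m) ≡⟨ count-+ f m (n ∸ m) ⟨
    count f (m + (n ∸ m))                  ≡⟨ cong (count f) (m+[n∸m]≡n m≤n) ⟩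
    count f n                              ∎
    where open ≤-Reasoning

  count-all : ∀ f n → (∀ {i} → i < n → P (f i)) → count f n ≡ n
  count-all f n all = trans (cong length (filter-all P? (All.applyUpTo⁺₁ f n all))) (length-applyUpTo f n)

  count-blocks : ∀ k b f → (∀ a {i} → i < k → P (f (a * suc k + i))) →
                 b * k ≤ count f (b * suc k)
  count-blocks k zero    f _  = z≤n
  count-blocks k (suc b) f hf = begin
    k + b * k                                        ≤⟨ +-mono-≤ first rest ⟩
    count f (suc k) + count (f ∘ (suc k +_)) (b * suc k) ≡⟨ count-+ f (suc k) (b * suc k) ⟨
    count f (suc k + b * suc k)                      ∎
    where
      open ≤-Reasoning
      first : k ≤ count f (suc k)
      first = subst (_≤ count f (suc k)) (count-all f k (hf 0)) (count-mono f (n≤1+n k))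
      rest : b * k ≤ count (f ∘ (suc k +_)) (b * suc k)
      rest = count-blocks k b (f ∘ (suc k +_))
               (λ a {i} i<k → subst (P ∘ f) (+-assoc (suc k) (a * suc k) i) (hf (suc a) i<k))

unique⊆⇒length≤ : ∀ {A : Set} (L S : List A) → Unique L → All (_∈ S) L → length L ≤ length S
unique⊆⇒length≤ []      S _            _          = z≤n
unique⊆⇒length≤ (x ∷ L) S (x∉L ∷ uL) (x∈S ∷ L⊆S) with ∈-∃++ x∈S
... | ys , zs , refl = begin
  suc (length L)               ≤⟨ s≤s (unique⊆⇒length≤ L (ys ++ zs) uL (remove x∉L L⊆S)) ⟩
  suc (length (ys ++ zs))      ≡⟨ cong suc (length-++ ys) ⟩
  suc (length ys + length zs)  ≡⟨ +-suc (length ys) (length zs) ⟨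
  length ys + length (x ∷ zs)  ≡⟨ length-++ ys ⟨
  length (ys ++ x ∷ zs)        ∎
  where
    open ≤-Reasoning
    drop : ∀ {y} ys → y ∈ ys ++ x ∷ zs → x ≢ y → y ∈ ys ++ zs
    drop []       (here y≡x) x≢y = ⊥-elim (x≢y (sym y≡x))
    drop []       (there y∈) _   = y∈
    drop (_ ∷ ys) (here y≡a) _   = here y≡a
    drop (_ ∷ ys) (there y∈) x≢y = there (drop ys y∈ x≢y)
    remove : ∀ {M} → All (x ≢_) M → All (_∈ ys ++ x ∷ zs) M → All (_∈ ys ++ zs) M
    remove []           []           = []
    remove (x≢y ∷ x≢M) (y∈ ∷ M⊆) = drop ys y∈ x≢y ∷ remove x≢M M⊆

length-cartesianProductWith : ∀ {A B C : Set} (f : A → B → C) xs ys →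
                              length (cartesianProductWith f xs ys) ≡ length xs * length ys
length-cartesianProductWith f []       ys = refl
length-cartesianProductWith f (x ∷ xs) ys = trans (length-++ (map (f x) ys))
  (cong₂ _+_ (length-map (f x) ys) (length-cartesianProductWith f xs ys))

-- Primes and coprimality

prime⇒2≤ : ∀ {p} → Prime p → 2 ≤ p
prime⇒2≤ {2+ _} _ = s≤s (s≤s z≤n)

prime⇒≤2*[∸1] : ∀ {p} → Prime p → p ≤ 2 * (p ∸ 1)
prime⇒≤2*[∸1] {2+ k} _ = m<m+n (suc k) z<s

coprime-* : ∀ {a b c} → Coprime a b → Coprime a c → Coprime a (b * c)
coprime-* a⊥b a⊥c (d∣a , d∣bc) =
  a⊥c (d∣a , coprime-divisor (λ (e∣d , e∣b) → a⊥b (∣-trans e∣d d∣a , e∣b)) d∣bc)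

coprime-^ : ∀ {a b} n → Coprime a b → Coprime a (b ^ n)
coprime-^ zero    _   (_ , d∣1) = ∣1⇒≡1 d∣1
coprime-^ (suc n) a⊥b = coprime-* a⊥b (coprime-^ n a⊥b)

∤⇒coprime : ∀ {p a} → Prime p → ¬ p ∣ a → Coprime a p
∤⇒coprime pp p∤a (d∣a , d∣p) with prime⇒irreducible pp d∣p
... | inj₁ d≡1    = d≡1
... | inj₂ refl   = ⊥-elim (p∤a d∣a)

*-∣-coprime : ∀ {m n c} → Coprime m n → m ∣ c → n ∣ c → m * n ∣ c
*-∣-coprime {m} {n} m⊥n m∣c n∣c = subst (_∣ _) lcm≡m*n (lcm-least m∣c n∣c)
  where
    lcm≡m*n : lcm m n ≡ m * n
    lcm≡m*n = trans (sym (*-identityˡ (lcm m n)))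
                (trans (cong (_* lcm m n) (sym (coprime⇒gcd≡1 m⊥n))) (gcd*lcm m n))

distinct-primes-coprime : ∀ {p q} → Prime p → Prime q → p ≢ q → Coprime p q
distinct-primes-coprime pp pq p≢q (d∣p , d∣q) with prime⇒irreducible pp d∣p
... | inj₁ d≡1  = d≡1
... | inj₂ refl with prime⇒irreducible pq d∣q
...   | inj₁ refl = ⊥-elim (¬prime[1] pp)
...   | inj₂ p≡q  = ⊥-elim (p≢q p≡q)

coprime-product : ∀ {a xs} → All (Coprime a) xs → Coprime a (product xs)
coprime-product []          = Coprimality.sym (Coprimality.1-coprimeTo _)
coprime-product (a⊥x ∷ a⊥xs) = coprime-* a⊥x (coprime-product a⊥xs)

product-∣ : ∀ {c xs} → All Prime xs → Unique xs → All (_∣ c) xs → product xs ∣ c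
product-∣ []          []          []          = 1∣ _
product-∣ {xs = x ∷ xs} (px ∷ pxs) (x∉xs ∷ uxs) (x∣c ∷ xs∣c) =
  *-∣-coprime (coprime-product x⊥xs) x∣c (product-∣ pxs uxs xs∣c)
  where
    x⊥xs : All (Coprime x) xs
    x⊥xs = All.zipWith (λ { (x≢y , py) {d} → distinct-primes-coprime px py x≢y {d} }) (x∉xs , pxs)

^-length≤product : ∀ {n} xs → All (n ≤_) xs → n ^ length xs ≤ product xs
^-length≤product []       []           = ≤-refl
^-length≤product (x ∷ xs) (n≤x ∷ n≤xs) = *-mono-≤ n≤x (^-length≤product xs n≤xs)

-- Totients of prime powers

p^j*[p∸1]≤φ[p^[1+j]] : ∀ {p} j → Prime p → p ^ j * (p ∸ 1) ≤ φ (p ^ suc j)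
p^j*[p∸1]≤φ[p^[1+j]] {p@(suc k)} j pp = begin
  p ^ j * k              ≤⟨ count-blocks P? k (p ^ j) id coprime-in-block ⟩
  count P? id (p ^ j * p) ≡⟨ cong (count P? id) (*-comm (p ^ j) p) ⟩
  φ N                    ∎
  where
    open ≤-Reasoning
    N = p ^ suc j
    P? : Decidable (λ m → gcd (suc m) N ≡ 1)
    P? m = gcd (suc m) N ≟ 1
    coprime-in-block : ∀ a {i} → i < k → gcd (suc (a * p + i)) N ≡ 1
    coprime-in-block a {i} i<k = coprime⇒gcd≡1 (coprime-^ (suc j) (∤⇒coprime pp p∤))
      where
        p∤ : ¬ p ∣ suc (a * p + i)
        p∤ p∣ = <⇒≱ (s≤s i<k) (∣⇒≤ (∣m+n∣m⇒∣n (subst (p ∣_) (sym (+-suc (a * p) i)) p∣) (n∣m*n a)))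

p^j≤2*φ[p^j] : ∀ {p} j → Prime p → 1 ≤ j → p ^ j ≤ 2 * φ (p ^ j)
p^j≤2*φ[p^j] {p} (suc j) pp _ = begin
  p * p ^ j             ≤⟨ *-monoˡ-≤ (p ^ j) (prime⇒≤2*[∸1] pp) ⟩
  2 * (p ∸ 1) * p ^ j   ≡⟨ *-assoc 2 (p ∸ 1) (p ^ j) ⟩
  2 * ((p ∸ 1) * p ^ j) ≡⟨ cong (2 *_) (*-comm (p ∸ 1) (p ^ j)) ⟩
  2 * (p ^ j * (p ∸ 1)) ≤⟨ *-monoʳ-≤ 2 (p^j*[p∸1]≤φ[p^[1+j]] j pp) ⟩
  2 * φ (p ^ suc j)     ∎
  where open ≤-Reasoning

-- Chebyshev's bound

nCk≤2^n : ∀ n k → n C k ≤ 2 ^ n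
nCk≤2^n zero    zero    = ≤-refl
nCk≤2^n zero    (suc k) = ≤-trans (≤-reflexive (k>n⇒nCk≡0 {0} {suc k} z<s)) z≤n
nCk≤2^n (suc n) zero    = ≤-trans (≤-reflexive (trans (nCk≡nC[n∸k] (z≤n {suc n})) (nCn≡1 (suc n)))) (m^n>0 2 (suc n))
nCk≤2^n (suc n) (suc k) = begin
  suc n C suc k       ≡⟨ nCk+nC[k+1]≡[n+1]C[k+1] n k ⟨
  n C k + n C suc k   ≤⟨ +-mono-≤ (nCk≤2^n n k) (nCk≤2^n n (suc k)) ⟩
  2 ^ n + 2 ^ n       ≡⟨ cong (2 ^ n +_) (+-identityʳ (2 ^ n)) ⟨
  2 ^ suc n           ∎
  where open ≤-Reasoning

[n+n]!≡C*n!*n! : ∀ n → (n + n) ! ≡ ((n + n) C n) * (n ! * n !)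
[n+n]!≡C*n!*n! n = begin
  (n + n) !                                           ≡⟨ m/n*n≡m {{n !* n !≢0}} n!*n!∣ ⟨
  ((n + n) ! / (n ! * n !)) {{n !* n !≢0}} * (n ! * n !) ≡⟨ cong (_* (n ! * n !)) C≡ ⟨
  ((n + n) C n) * (n ! * n !)                           ∎
  where
    open ≡-Reasoning
    n!*n!∣ : n ! * n ! ∣ (n + n) !
    n!*n!∣ = subst (λ z → n ! * z ! ∣ (n + n) !) (m+n∸n≡m n n) (k![n∸k]!∣n! (m≤n+m n n))
    C≡ : (n + n) C n ≡ ((n + n) ! / (n ! * n !)) {{n !* n !≢0}}
    C≡ with n + n ∸ n | m+n∸n≡m n n | nCk≡n!/k![n-k]! {n + n} {n} (m≤n+m n n)
    ... | _ | refl | eq = eq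

prime∤! : ∀ {p} n → Prime p → n < p → ¬ p ∣ n !
prime∤! zero    pp _   p∣1 = ¬prime[1] (subst Prime (∣1⇒≡1 p∣1) pp)
prime∤! (suc n) pp n<p p∣ with euclidsLemma (suc n) (n !) pp p∣
... | inj₁ p∣n+1 = <⇒≱ n<p (∣⇒≤ p∣n+1)
... | inj₂ p∣n!  = prime∤! n pp (<-trans (n<1+n n) n<p) p∣n!

prime-∣-central-binomial : ∀ {p} n → Prime p → n < p → p ≤ n + n → p ∣ (n + n) C n
prime-∣-central-binomial {p@(suc k)} n pp n<p p≤2n
  with euclidsLemma ((n + n) C n) (n ! * n !) pp
         (subst (p ∣_) ([n+n]!≡C*n!*n! n) (∣-trans (m∣m*n (k !)) (m≤n⇒m!∣n! p≤2n)))
... | inj₁ p∣C   = p∣C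
... | inj₂ p∣n!² with euclidsLemma (n !) (n !) pp p∣n!²
...   | inj₁ p∣n! = ⊥-elim (prime∤! n pp n<p p∣n!)
...   | inj₂ p∣n! = ⊥-elim (prime∤! n pp n<p p∣n!)

primesBetween : ℕ → List ℕ
primesBetween n = filter prime? (applyUpTo (suc n +_) n)

product-primesBetween-∣ : ∀ n → product (primesBetween n) ∣ (n + n) C n
product-primesBetween-∣ n = product-∣
  (All.all-filter prime? candidates)
  (Unique.filter⁺ prime? (Unique.applyUpTo⁺₁ (suc n +_) n (λ i<j _ → <⇒≢ (+-monoʳ-< (suc n) i<j))))
  (All.zipWith (λ (∣-if-prime , p-prime) → ∣-if-prime p-prime)
    (All.filter⁺ prime? ∣C-if-prime , All.all-filter prime? candidates))
  where
    candidates : List ℕ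
    candidates = applyUpTo (suc n +_) n
    ∣C-if-prime : All (λ p → Prime p → p ∣ (n + n) C n) candidates
    ∣C-if-prime = All.applyUpTo⁺₁ (suc n +_) n λ {i} i<n p-prime →
      prime-∣-central-binomial n p-prime (s≤s (m≤m+n n i)) (+-monoʳ-< n i<n)

^-length-primesBetween≤4^n : ∀ n → n ^ length (primesBetween n) ≤ 2 ^ (n + n)
^-length-primesBetween≤4^n n = begin
  n ^ length (primesBetween n) ≤⟨ ^-length≤product (primesBetween n) (All.filter⁺ prime? above-n) ⟩
  product (primesBetween n)    ≤⟨ ∣⇒≤ {{C≢0}} (product-primesBetween-∣ n) ⟩
  (n + n) C n                  ≤⟨ nCk≤2^n (n + n) n ⟩
  2 ^ (n + n)                  ∎
  where
    open ≤-Reasoning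
    above-n : All (n ≤_) (applyUpTo (suc n +_) n)
    above-n = All.applyUpTo⁺₁ (suc n +_) n (λ {i} _ → m≤n⇒m≤1+n (m≤m+n n i))
    C≢0 : NonZero ((n + n) C n)
    C≢0 = ≢-nonZero λ C≡0 → <⇒≢ (1≤n! (n + n)) (sym (trans ([n+n]!≡C*n!*n! n) (cong (_* (n ! * n !)) C≡0)))

K*length-primesBetween≤n : ∀ K n → 2 ^ (2 * K) ≤ n → K * length (primesBetween n) ≤ n
K*length-primesBetween≤n K n 4^K≤n with K * length (primesBetween n) ≤? n
... | yes bounded = bounded
... | no  n<Kb    = ⊥-elim (<⇒≱ 4^n<n^b (^-length-primesBetween≤4^n n))
  where
    open ≤-Reasoning
    b = length (primesBetween n)
    n+n<2*[1+n] : n + n < 2 * suc n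
    n+n<2*[1+n] = +-mono-<-≤ (n<1+n n) (≤-trans (n≤1+n n) (≤-reflexive (sym (+-identityʳ (suc n)))))
    4^n<n^b : 2 ^ (n + n) < n ^ b
    4^n<n^b = begin-strict
      2 ^ (n + n)         <⟨ ^-monoʳ-< 2 (s≤s (s≤s z≤n)) n+n<2*[1+n] ⟩
      2 ^ (2 * suc n)     ≤⟨ ^-monoʳ-≤ 2 (*-monoʳ-≤ 2 (≰⇒> n<Kb)) ⟩
      2 ^ (2 * (K * b))   ≡⟨ cong (2 ^_) (*-assoc 2 K b) ⟨
      2 ^ (2 * K * b)     ≡⟨ ^-*-assoc 2 (2 * K) b ⟨
      (2 ^ (2 * K)) ^ b   ≤⟨ ^-monoˡ-≤ b 4^K≤n ⟩
      n ^ b               ∎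

π : ℕ → ℕ
π = count prime? id

π-sublinear : ∀ K → Σ ℕ λ D → ∀ Y → K * π Y ≤ Y + D
π-sublinear K = D , <-rec _ bound
  where
    N₀ = 2 ^ (2 * (2 * K))
    D = K * (suc N₀ + suc N₀)
    bound : ∀ Y → (∀ {Z} → Z < Y → K * π Z ≤ Z + D) → K * π Y ≤ Y + D
    bound Y rec with Y <? suc N₀ + suc N₀ | halve Y
    ... | yes small | _ = ≤-trans (*-monoʳ-≤ K (≤-trans (count≤n prime? id Y) (<⇒≤ small))) (m≤n+m D Y)
    ... | no  large | n , n+n≤Y , Y≤2n+1 = begin
      K * π Y                                   ≤⟨ *-monoʳ-≤ K (count-mono prime? id Y≤2n+1) ⟩
      K * π (suc n + n)                         ≡⟨ cong (K *_) (count-+ prime? id (suc n) n) ⟩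
      K * (π (suc n) + b)                       ≡⟨ *-distribˡ-+ K (π (suc n)) b ⟩
      K * π (suc n) + K * b                     ≤⟨ +-monoˡ-≤ (K * b) (rec (<-≤-trans n+1<n+n n+n≤Y)) ⟩
      suc n + D + K * b                         ≡⟨ +-CS.xy∙z≈xz∙y (suc n) D (K * b) ⟩
      suc n + K * b + D                         ≤⟨ +-monoˡ-≤ D (≤-trans (+-monoʳ-< n Kb<n) n+n≤Y) ⟩
      Y + D                                     ∎
      where
        open ≤-Reasoning
        b = length (primesBetween n)
        N₀<n : N₀ < n
        N₀<n with N₀ <? n
        ... | yes N₀<n = N₀<n
        ... | no  N₀≮n = ⊥-elim (large (≤-<-trans Y≤2n+1 (+-mono-≤-< (s≤s n≤N₀) (s≤s n≤N₀))))
          where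
            n≤N₀ : n ≤ N₀
            n≤N₀ = ≮⇒≥ N₀≮n
        2≤n : 2 ≤ n
        2≤n = <-≤-trans (s≤s (m^n>0 2 (2 * (2 * K)))) N₀<n
        n+1<n+n : suc n < n + n
        n+1<n+n = +-monoˡ-< n 2≤n
        Kb<n : K * b < n
        Kb<n = 2*m≤n⇒m<n 2≤n
                 (≤-trans (≤-reflexive (sym (*-assoc 2 K b))) (K*length-primesBetween≤n (2 * K) n (<⇒≤ N₀<n)))

-- Prime powers from a least factor

firstDivisorFrom : ℕ → ℕ → ℕ → ℕ
firstDivisorFrom d zero    u = d
firstDivisorFrom d (suc f) u with d ∣? u
... | yes _ = d
... | no  _ = firstDivisorFrom (suc d) f u

firstDivisorFrom-≡ : ∀ {q u} f d → d ≤ q → q ≤ d + f → q ∣ u →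
                     (∀ {e} → d ≤ e → e < q → ¬ e ∣ u) → firstDivisorFrom d f u ≡ q
firstDivisorFrom-≡ zero d d≤q q≤d+0 _ _ = ≤-antisym d≤q (≤-trans q≤d+0 (≤-reflexive (+-identityʳ d)))
firstDivisorFrom-≡ {u = u} (suc f) d d≤q q≤d+f q∣u below with d ∣? u | m≤n⇒m<n∨m≡n d≤q
... | yes d∣u | inj₁ d<q = ⊥-elim (below ≤-refl d<q d∣u)
... | yes _   | inj₂ d≡q = d≡q
... | no  d∤u | inj₂ refl = ⊥-elim (d∤u q∣u)
... | no  _   | inj₁ d<q =
  firstDivisorFrom-≡ f (suc d) d<q (≤-trans q≤d+f (≤-reflexive (+-suc d f))) q∣u
    (λ d<e → below (<⇒≤ d<e))

minFactor : ℕ → ℕ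
minFactor u = firstDivisorFrom 2 u u

minFactor-prime-^ : ∀ {p} s → Prime p → minFactor (p ^ suc s) ≡ p
minFactor-prime-^ {p} s pp =
  firstDivisorFrom-≡ (p ^ suc s) 2 (prime⇒2≤ pp) (≤-trans p≤p^[1+s] (m≤n+m _ 2)) (m∣m*n (p ^ s)) no-smaller
  where
    instance
      _ = prime⇒nonZero pp
    p≤p^[1+s] : p ≤ p ^ suc s
    p≤p^[1+s] = m≤m*n p (p ^ s) {{m^n≢0 p s}}
    no-smaller : ∀ {e} → 2 ≤ e → e < p → ¬ e ∣ p ^ suc s
    no-smaller {suc e} 2≤e e<p e∣ =
      <⇒≢ 2≤e (sym (coprime-^ (suc s) (Coprimality.sym (prime⇒coprime pp e<p)) (∣-refl , e∣)))

prime-^-split : ∀ {q} e .{{_ : NonZero e}} j → Prime q → e ≤ j →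
                Σ ℕ λ u → Σ ℕ λ r → r < e × u ^ e ≤ q ^ j × q ^ j ≡ u ^ e * minFactor u ^ r
prime-^-split {q} e j pq e≤j with j / e | m≥n⇒m/n>0 e≤j | m≡m%n+[m/n]*n j e
... | suc s | _ | j≡r+s*e = q ^ suc s , j % e , m%n<n j e , u^e≤q^j , q^j≡
  where
    instance
      _ = prime⇒nonZero pq
    u^e≡ : (q ^ suc s) ^ e ≡ q ^ (suc s * e)
    u^e≡ = ^-*-assoc q (suc s) e
    u^e≤q^j : (q ^ suc s) ^ e ≤ q ^ j
    u^e≤q^j = ≤-trans (≤-reflexive u^e≡) (^-monoʳ-≤ q (≤-trans (m≤n+m _ (j % e)) (≤-reflexive (sym j≡r+s*e))))
    q^j≡ : q ^ j ≡ (q ^ suc s) ^ e * minFactor (q ^ suc s) ^ (j % e)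
    q^j≡ = begin
      q ^ j                                        ≡⟨ cong (q ^_) j≡r+s*e ⟩
      q ^ (j % e + suc s * e)                      ≡⟨ ^-distribˡ-+-* q (j % e) (suc s * e) ⟩
      q ^ (j % e) * q ^ (suc s * e)                ≡⟨ *-comm (q ^ (j % e)) _ ⟩
      q ^ (suc s * e) * q ^ (j % e)                ≡⟨ cong₂ _*_ (sym u^e≡) (cong (_^ (j % e)) (sym (minFactor-prime-^ s pq))) ⟩
      (q ^ suc s) ^ e * minFactor (q ^ suc s) ^ (j % e) ∎
      where open ≡-Reasoning

-- Counting 𝓡_t

φ[q^t]-candidates : ℕ → ℕ → List ℕ
φ[q^t]-candidates t w = map (λ q → φ (q ^ t)) (filter prime? (upTo (2 * w)))

φ[q^>t]-candidates : (t c w : ℕ) .{{_ : NonZero c}} → List ℕ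
φ[q^>t]-candidates t c w = cartesianProductWith (λ u r → φ (u ^ suc t * minFactor u ^ r))
                             (upTo (suc (w / c))) (upTo (suc t))

length-candidates : ∀ t c w .{{_ : NonZero c}} →
  length (φ[q^t]-candidates t w ++ φ[q^>t]-candidates t c w) ≡ π (2 * w) + suc (w / c) * suc t
length-candidates t c w = trans (length-++ (φ[q^t]-candidates t w)) (cong₂ _+_
  (length-map _ (filter prime? (upTo (2 * w))))
  (trans (length-cartesianProductWith _ (upTo (suc (w / c))) (upTo (suc t)))
         (cong₂ _*_ (length-upTo (suc (w / c))) (length-upTo (suc t)))))

φ[q^j]∈candidates : ∀ {q j} t c w .{{_ : NonZero t}} .{{_ : NonZero c}} → 2 * c ^ suc t < w →
  Prime q → t ≤ j → q ^ j < 2 * w ^ t → φ (q ^ j) ∈ φ[q^t]-candidates t w ++ φ[q^>t]-candidates t c w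
φ[q^j]∈candidates {q} {j} t c w 2c^[1+t]<w pq t≤j q^j<2w^t with m≤n⇒m<n∨m≡n t≤j
... | inj₂ refl = ∈-++⁺ˡ (∈-map⁺ (λ q → φ (q ^ t))
                    (∈-filter⁺ prime? (∈-upTo⁺ (m^n<2*o^n⇒m<2*o t q^j<2w^t)) pq))
... | inj₁ t<j with prime-^-split (suc t) j pq t<j
...   | u , r , r≤t , u^[1+t]≤q^j , q^j≡ =
  subst (_∈ _) (cong φ (sym q^j≡)) (∈-++⁺ʳ (φ[q^t]-candidates t w)
    (∈-cartesianProductWith⁺ (λ u r → φ (u ^ suc t * minFactor u ^ r)) (∈-upTo⁺ u<1+w/c) (∈-upTo⁺ r≤t)))
  where
    u<1+w/c : u < suc (w / c)
    u<1+w/c = s≤s (≤-trans (≤-reflexive (sym (m*n/n≡m u c))) (/-monoˡ-≤ c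
                (<⇒≤ (u^[1+t]<2*w^t⇒u*c<w {u} c t (≤-<-trans u^[1+t]≤q^j q^j<2w^t) 2c^[1+t]<w))))

length-R-list≤ : ∀ t c w x L .{{_ : NonZero t}} .{{_ : NonZero c}} → 2 * c ^ suc t < w → x < w ^ t →
  Unique L → All (λ k → k ≤ x × R t k) L → length L ≤ π (2 * w) + suc (w / c) * suc t
length-R-list≤ t c w x L 2c^[1+t]<w x<w^t uL L⊆R = begin
  length L                                                       ≤⟨ unique⊆⇒length≤ L _ uL (All.map in-candidates L⊆R) ⟩
  length (φ[q^t]-candidates t w ++ φ[q^>t]-candidates t c w)     ≡⟨ length-candidates t c w ⟩
  π (2 * w) + suc (w / c) * suc t                                ∎
  where
    open ≤-Reasoning
    in-candidates : ∀ {k} → k ≤ x × R t k → k ∈ φ[q^t]-candidates t w ++ φ[q^>t]-candidates t c w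
    in-candidates {k} (k≤x , _ , q , j , pq , t≤j , φ[q^j]≡k) =
      subst (_∈ _) φ[q^j]≡k (φ[q^j]∈candidates t c w 2c^[1+t]<w pq t≤j (begin-strict
        q ^ j           ≤⟨ p^j≤2*φ[p^j] j pq (≤-trans (>-nonZero⁻¹ t) t≤j) ⟩
        2 * φ (q ^ j)   ≤⟨ *-monoʳ-≤ 2 (≤-trans (≤-reflexive φ[q^j]≡k) k≤x) ⟩
        2 * x           <⟨ *-monoʳ-< 2 x<w^t ⟩
        2 * w ^ t       ∎))

m*N≤D+4*m*T : ∀ m T N P D .{{_ : NonZero (4 * m * T)}} →
  N ≤ P + suc (m * N / (4 * m * T)) * T → 4 * m * P ≤ 2 * (m * N) + D → m * N ≤ D + 4 * m * T
m*N≤D+4*m*T m T N P D N≤ 4mP≤ = +-cancelʳ-≤ (3 * w) w (D + c) (begin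
  w + 3 * w                         ≡⟨ regroup₁ m N ⟩
  4 * m * N                         ≤⟨ *-monoʳ-≤ (4 * m) N≤ ⟩
  4 * m * (P + suc (w / c) * T)     ≡⟨ regroup₂ m P (w / c) T ⟩
  4 * m * P + suc (w / c) * c       ≤⟨ +-mono-≤ 4mP≤ (+-monoʳ-≤ c (m/n*n≤m w c)) ⟩
  2 * w + D + (c + w)               ≡⟨ regroup₃ w D c ⟩
  D + c + 3 * w                     ∎)
  where
    open ≤-Reasoning
    w = m * N
    c = 4 * m * T
    regroup₁ : ∀ m N → m * N + 3 * (m * N) ≡ 4 * m * N
    regroup₁ = solve-∀
    regroup₂ : ∀ m P q T → 4 * m * (P + suc q * T) ≡ 4 * m * P + suc q * (4 * m * T)
    regroup₂ = solve-∀
    regroup₃ : ∀ w D c → 2 * w + D + (c + w) ≡ D + c + 3 * w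
    regroup₃ = solve-∀

lemma2p1 : (t : ℕ) → 1 ≤ t → (m : ℕ) → 1 ≤ m →
    Σ ℕ λ X → (x : ℕ) → X ≤ x → (L : List ℕ) → Unique L →
      All (λ k → k ≤ x × R t k) L → (m ^ t) * (length L ^ t) ≤ x
lemma2p1 t 1≤t m 1≤m = W ^ t , bounded
  where
    c = 4 * m * suc t
    instance
      _ = >-nonZero 1≤t
      _ = >-nonZero 1≤m
      c≢0 : NonZero c
      c≢0 = m*n≢0 (4 * m) (suc t) {{m*n≢0 4 m}}
    D = proj₁ (π-sublinear (4 * m))
    W = D + c + 2 * c ^ suc t
    bounded : (x : ℕ) → W ^ t ≤ x → (L : List ℕ) → Unique L →
              All (λ k → k ≤ x × R t k) L → (m ^ t) * (length L ^ t) ≤ x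
    bounded x W^t≤x L uL L⊆R with m * length L ≤? W | (m * length L) ^ t ≤? x
    ... | yes w≤W | _         = subst (_≤ x) (^-distribʳ-* m (length L) t) (≤-trans (^-monoˡ-≤ t w≤W) W^t≤x)
    ... | no  _   | yes w^t≤x = subst (_≤ x) (^-distribʳ-* m (length L) t) w^t≤x
    ... | no  w≰W | no  w^t≰x = ⊥-elim (w≰W (≤-trans w≤D+c (m≤m+n (D + c) _)))
      where
        w = m * length L
        w≤D+c : w ≤ D + c
        w≤D+c = m*N≤D+4*m*T m (suc t) (length L) (π (2 * w)) D
          (length-R-list≤ t c w x L (≤-<-trans (m≤n+m (2 * c ^ suc t) (D + c)) (≰⇒> w≰W)) (≰⇒> w^t≰x) uL L⊆R)
          (proj₂ (π-sublinear (4 * m)) (2 * w))
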